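{- For each integer $n\ge 0$ let $\rho_o(n)$ denote the number of partitions of $n$ in which the largest part $\ell$ appears exactly once, all remaining parts are odd, and the remaining parts (all strictly smaller than $\ell$) form a partition of $\ell$ (the largest part $\ell$ itself may be even or odd). Then $$\sum_{n=0}^{\infty}\rho_o(n)q^n=\frac{1}{(q^2;q^4)_{\infty}}-\frac{q^2}{1-q^4}-1.$$
   Context: A partition of a positive integer $n$ is a way of writing $n$ as a sum of positive integers (parts), listed in non-increasing order; the empty partition has no largest part and is not counted. For $|q|<1$, $(t;q)_0=1$, $(t;q)_n=(1-t)(1-tq)\cdots(1-tq^{n-1})$ for $n>0$, and $(t;q)_\infty=\lim_{n\to\infty}(t;q)_n$. -}

module Defs where

open import Data.Nat as ℕ using (ℕ; zero; suc; _≥_; _<_)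
open import Data.Integer as ℤ using (ℤ; +_)
open import Data.List using (List; []; _∷_)
open import Data.Nat.ListAction using (sum)
open import Data.List.Relation.Unary.All using (All)
open import Data.List.Relation.Unary.Linked using (Linked)
open import Data.Product using (Σ; ∃; _×_)
open import Relation.Binary.PropositionalEquality using (_≡_)

record IsPartition (n : ℕ) (p : List ℕ) : Set where
  field
    positive    : All (λ x → 1 ℕ.≤ x) p
    nonIncr     : Linked _≥_ p
    sumEq       : sum p ≡ n

Odd : ℕ → Set
Odd m = ∃ λ k → m ≡ suc (2 ℕ.* k)

data RhoO : List ℕ → Set where
  rhoO : (ℓ : ℕ) (rest : List ℕ) →
         All (λ x → x < ℓ) rest →
         All Odd rest →
         IsPartition ℓ rest →
         RhoO (ℓ ∷ rest)

PS : Set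
PS = ℕ → ℤ

sumTo : ℕ → (ℕ → ℤ) → ℤ
sumTo zero    f = f 0
sumTo (suc n) f = sumTo n f ℤ.+ f (suc n)

one : PS
one zero    = + 1
one (suc _) = + 0

qpow : ℕ → PS
qpow zero    zero    = + 1
qpow zero    (suc _) = + 0
qpow (suc m) zero    = + 0
qpow (suc m) (suc n) = qpow m n

_⊕_ : PS → PS → PS
(f ⊕ g) n = f n ℤ.+ g n

_⊖_ : PS → PS → PS
(f ⊖ g) n = f n ℤ.- g n

_⊛_ : PS → PS → PS
(f ⊛ g) n = sumTo n (λ i → f i ℤ.* g (n ℕ.∸ i))

infixl 7 _⊛_
infixl 6 _⊕_ _⊖_

_^ˢ_ : PS → ℕ → PS
f ^ˢ zero  = one
f ^ˢ suc k = f ⊛ (f ^ˢ k)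

-- Inverse of a series f with constant term 1, via the geometric series
-- 1/f = 1/(1 - (1 - f)) = Σ_k (1 - f)^k; since (1 - f) has zero constant
-- term, only k ≤ n contribute to the coefficient of q^n.
inv₁ : PS → PS
inv₁ f n = sumTo n (λ k → ((one ⊖ f) ^ˢ k) n)

poch-q2-q4 : ℕ → PS
poch-q2-q4 zero    = one
poch-q2-q4 (suc N) = poch-q2-q4 N ⊛ (one ⊖ qpow (4 ℕ.* N ℕ.+ 2))

-- Right-hand side with the infinite product truncated at N:
--   1/(q^2;q^4)_N - q^2/(1-q^4) - 1
-- Its coefficient of q^n agrees with that of the infinite product version
-- as soon as 4N+2 > n.
rhsN : ℕ → PS
rhsN N = inv₁ (poch-q2-q4 N) ⊖ qpow 2 ⊛ inv₁ (one ⊖ qpow 4) ⊖ one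

-- A partition counted by ρ_o(n) is ℓ followed by a partition of ℓ into odd parts below ℓ, so
-- ρ_o vanishes at 0 and at odd n, and ρ_o(2ℓ) = p_odd(ℓ) − [ℓ odd] for ℓ ≥ 1: when ℓ is odd the
-- one-part partition ℓ is excluded. On the series side everything is a series in q²:
-- 1/(q²;q⁴)_N = Σ p_{odd<2N}(ℓ) q^{2ℓ}, where p_{odd<2N}(ℓ) = p_odd(ℓ) for ℓ ≤ 2N, and
-- q²/(1−q⁴) = Σ_{ℓ odd} q^{2ℓ}. Partitions with parts from a decreasing list are enumerated
-- by a generator whose count satisfies c(v ∷ vs, m) = c(vs, m) + c(v ∷ vs, m − v), which is
-- the identity (1 − q^v) P_{v ∷ vs} = P_{vs}; hence (q²;q⁴)_N times the dilated partition
-- series is 1, and a series with that property is the truncated geometric expansion inv₁.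
module Submission where

open import Defs
open import Data.Nat using (ℕ; _<_; _+_; _*_)
open import Data.Integer using (+_)
open import Data.List using (List; length)
open import Data.List.Membership.Propositional using (_∈_)
open import Data.List.Relation.Unary.Unique.Propositional using (Unique)
open import Data.Product using (Σ; _×_)
open import Function.Bundles using (_⇔_)
open import Relation.Binary.PropositionalEquality using (_≡_)

open import Data.Nat as ℕ using (zero; suc; _≤_; _>_; _≥_; _≤′_; z≤n; s≤s; _∸_; _≤?_)
import Data.Nat.Properties as ℕ
import Data.Nat.Tactic.RingSolver as ℕ-Solver
open import Data.Nat.ListAction using (sum)
open import Data.Integer as ℤ using (ℤ) renaming (_+_ to _+ᶻ_; _-_ to _-ᶻ_; _*_ to _*ᶻ_)
import Data.Integer.Properties as ℤ
open import Data.Integer.Tactic.RingSolver using (solve-∀)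
open import Data.List using ([]; _∷_; [_]; _++_; map)
open import Data.List.Properties using (length-++; length-map; ∷-injectiveʳ)
open import Data.List.Relation.Unary.All as All using (All; []; _∷_)
open import Data.List.Relation.Unary.AllPairs using (AllPairs; []; _∷_)
open import Data.List.Relation.Unary.Any using (here; there)
open import Data.List.Relation.Unary.Linked as Linked using (Linked; []; [-]; _∷_)
open import Data.List.Relation.Unary.Linked.Properties using (Linked⇒AllPairs)
open import Data.List.Membership.Propositional.Properties using (∈-map⁺; ∈-map⁻; ∈-++⁺ˡ; ∈-++⁺ʳ; ∈-++⁻)
import Data.List.Relation.Unary.Unique.Propositional.Properties as Unique
open import Data.Product using (_,_; proj₁; proj₂; swap; map₂; uncurry)
open import Data.Sum using (inj₁; inj₂)
open import Data.Empty using (⊥-elim)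
open import Function using (_∘_; flip)
open import Function.Bundles using (mk⇔; Equivalence)
open import Relation.Nullary using (¬_; yes; no)
open import Relation.Binary.PropositionalEquality
  using (_≢_; refl; sym; trans; cong; cong₂; subst; module ≡-Reasoning)

open IsPartition
open Equivalence

infix 4 _≈_

_≈_ : PS → PS → Set
f ≈ g = ∀ m → f m ≡ g m

sumTo-cong : ∀ n {f g : ℕ → ℤ} → (∀ i → i ≤ n → f i ≡ g i) → sumTo n f ≡ sumTo n g
sumTo-cong zero    f≗g = f≗g 0 z≤n
sumTo-cong (suc n) f≗g =
  cong₂ _+ᶻ_ (sumTo-cong n λ i i≤n → f≗g i (ℕ.m≤n⇒m≤1+n i≤n)) (f≗g (suc n) ℕ.≤-refl)

sumTo-zero : ∀ n {f : ℕ → ℤ} → (∀ i → i ≤ n → f i ≡ + 0) → sumTo n f ≡ + 0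
sumTo-zero n f≗0 = trans (sumTo-cong n {g = λ _ → + 0} f≗0) (sumTo-const-zero n)
  where
  sumTo-const-zero : ∀ n → sumTo n (λ _ → + 0) ≡ + 0
  sumTo-const-zero zero    = refl
  sumTo-const-zero (suc n) = cong (_+ᶻ + 0) (sumTo-const-zero n)

sumTo-+ : ∀ n (f g : ℕ → ℤ) → sumTo n (λ i → f i +ᶻ g i) ≡ sumTo n f +ᶻ sumTo n g
sumTo-+ zero    f g = refl
sumTo-+ (suc n) f g = trans (cong (_+ᶻ (f (suc n) +ᶻ g (suc n))) (sumTo-+ n f g))
  (interchange (sumTo n f) (sumTo n g) (f (suc n)) (g (suc n)))
  where
  interchange : ∀ a b c d → (a +ᶻ b) +ᶻ (c +ᶻ d) ≡ (a +ᶻ c) +ᶻ (b +ᶻ d)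
  interchange = solve-∀

sumTo-minus : ∀ n (f g : ℕ → ℤ) → sumTo n (λ i → f i -ᶻ g i) ≡ sumTo n f -ᶻ sumTo n g
sumTo-minus zero    f g = refl
sumTo-minus (suc n) f g = trans (cong (_+ᶻ (f (suc n) -ᶻ g (suc n))) (sumTo-minus n f g))
  (interchange (sumTo n f) (sumTo n g) (f (suc n)) (g (suc n)))
  where
  interchange : ∀ a b c d → (a -ᶻ b) +ᶻ (c -ᶻ d) ≡ (a +ᶻ c) -ᶻ (b +ᶻ d)
  interchange = solve-∀

*-distribˡ-sumTo : ∀ n c (f : ℕ → ℤ) → c *ᶻ sumTo n f ≡ sumTo n (λ i → c *ᶻ f i)
*-distribˡ-sumTo zero    c f = refl
*-distribˡ-sumTo (suc n) c f =
  trans (ℤ.*-distribˡ-+ c (sumTo n f) (f (suc n))) (cong (_+ᶻ c *ᶻ f (suc n)) (*-distribˡ-sumTo n c f))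

sumTo-suc : ∀ n (f : ℕ → ℤ) → sumTo (suc n) f ≡ f 0 +ᶻ sumTo n (f ∘ suc)
sumTo-suc zero    f = refl
sumTo-suc (suc n) f = trans (cong (_+ᶻ f (suc (suc n))) (sumTo-suc n f)) (ℤ.+-assoc (f 0) _ _)

sumTo-comm : ∀ n K (F : ℕ → ℕ → ℤ) →
  sumTo n (λ i → sumTo K (F i)) ≡ sumTo K (λ k → sumTo n (λ i → F i k))
sumTo-comm zero    K F = refl
sumTo-comm (suc n) K F = trans (cong (_+ᶻ sumTo K (F (suc n))) (sumTo-comm n K F))
  (sym (sumTo-+ K (λ k → sumTo n (λ i → F i k)) (F (suc n))))

⊛-congˡ : ∀ {f g} h → f ≈ g → f ⊛ h ≈ g ⊛ h
⊛-congˡ h f≈g m = sumTo-cong m λ i _ → cong (_*ᶻ h (m ∸ i)) (f≈g i)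

⊛-congʳ : ∀ f {g h} → g ≈ h → f ⊛ g ≈ f ⊛ h
⊛-congʳ f g≈h m = sumTo-cong m λ i _ → cong (f i *ᶻ_) (g≈h (m ∸ i))

⊛-distribˡ-⊕ : ∀ f g h → f ⊛ (g ⊕ h) ≈ f ⊛ g ⊕ f ⊛ h
⊛-distribˡ-⊕ f g h m =
  trans (sumTo-cong m λ i _ → ℤ.*-distribˡ-+ (f i) (g (m ∸ i)) (h (m ∸ i))) (sumTo-+ m _ _)

⊛-distribˡ-⊖ : ∀ f g h → f ⊛ (g ⊖ h) ≈ f ⊛ g ⊖ f ⊛ h
⊛-distribˡ-⊖ f g h m = trans (sumTo-cong m λ i _ → distrib (f i) (g (m ∸ i)) (h (m ∸ i))) (sumTo-minus m _ _)
  where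
  distrib : ∀ a b c → a *ᶻ (b -ᶻ c) ≡ a *ᶻ b -ᶻ a *ᶻ c
  distrib = solve-∀

⊛-distribʳ-⊖ : ∀ f g h → (f ⊖ g) ⊛ h ≈ f ⊛ h ⊖ g ⊛ h
⊛-distribʳ-⊖ f g h m = trans (sumTo-cong m λ i _ → distrib (f i) (g i) (h (m ∸ i))) (sumTo-minus m _ _)
  where
  distrib : ∀ a b c → (a -ᶻ b) *ᶻ c ≡ a *ᶻ c -ᶻ b *ᶻ c
  distrib = solve-∀

⊛-identityˡ : ∀ f → one ⊛ f ≈ f
⊛-identityˡ f zero    = ℤ.*-identityˡ (f 0)
⊛-identityˡ f (suc m) = begin
  sumTo (suc m) (λ i → one i *ᶻ f (suc m ∸ i))
    ≡⟨ sumTo-suc m _ ⟩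
  + 1 *ᶻ f (suc m) +ᶻ sumTo m (λ _ → + 0)
    ≡⟨ cong₂ _+ᶻ_ (ℤ.*-identityˡ (f (suc m))) (sumTo-zero m λ _ _ → refl) ⟩
  f (suc m) +ᶻ + 0
    ≡⟨ ℤ.+-identityʳ _ ⟩
  f (suc m)
    ∎
  where open ≡-Reasoning

⊛-identityʳ : ∀ f → f ⊛ one ≈ f
⊛-identityʳ f zero    = ℤ.*-identityʳ (f 0)
⊛-identityʳ f (suc m) = begin
  sumTo m (λ i → f i *ᶻ one (suc m ∸ i)) +ᶻ f (suc m) *ᶻ one (m ∸ m)
    ≡⟨ cong₂ _+ᶻ_ (sumTo-zero m λ i i≤m →
                     trans (cong (λ k → f i *ᶻ one k) (ℕ.+-∸-assoc 1 i≤m)) (ℤ.*-zeroʳ (f i)))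
                   (cong (λ k → f (suc m) *ᶻ one k) (ℕ.n∸n≡0 m)) ⟩
  + 0 +ᶻ f (suc m) *ᶻ + 1
    ≡⟨ trans (ℤ.+-identityˡ _) (ℤ.*-identityʳ (f (suc m))) ⟩
  f (suc m)
    ∎
  where open ≡-Reasoning

shift₁ : PS → PS
shift₁ f zero    = + 0
shift₁ f (suc m) = f m

shift : ℕ → PS → PS
shift zero    f = f
shift (suc a) f = shift₁ (shift a f)

shift₁-cong : ∀ {f g} → f ≈ g → shift₁ f ≈ shift₁ g
shift₁-cong f≈g zero    = refl
shift₁-cong f≈g (suc m) = f≈g m

shift-cong : ∀ a {f g} → f ≈ g → shift a f ≈ shift a g
shift-cong zero    f≈g = f≈g
shift-cong (suc a) f≈g = shift₁-cong (shift-cong a f≈g)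

shift-≤ : ∀ a f {m} → a ≤ m → shift a f m ≡ f (m ∸ a)
shift-≤ zero    f a≤m       = refl
shift-≤ (suc a) f (s≤s a≤m) = shift-≤ a f a≤m

shift-< : ∀ a f {m} → m < a → shift a f m ≡ + 0
shift-< (suc a) f {zero}  m<a       = refl
shift-< (suc a) f {suc m} (s≤s m<a) = shift-< a f m<a

shift₁-⊛ : ∀ f g → shift₁ f ⊛ g ≈ shift₁ (f ⊛ g)
shift₁-⊛ f g zero    = refl
shift₁-⊛ f g (suc m) = trans (sumTo-suc m _) (ℤ.+-identityˡ ((f ⊛ g) m))

⊛-shift₁ : ∀ f g → f ⊛ shift₁ g ≈ shift₁ (f ⊛ g)
⊛-shift₁ f g zero    = ℤ.*-zeroʳ (f 0)
⊛-shift₁ f g (suc m) = begin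
  sumTo m (λ i → f i *ᶻ shift₁ g (suc m ∸ i)) +ᶻ f (suc m) *ᶻ shift₁ g (m ∸ m)
    ≡⟨ cong₂ _+ᶻ_ (sumTo-cong m λ i i≤m → cong (λ k → f i *ᶻ shift₁ g k) (ℕ.+-∸-assoc 1 i≤m))
                   (trans (cong (λ k → f (suc m) *ᶻ shift₁ g k) (ℕ.n∸n≡0 m)) (ℤ.*-zeroʳ (f (suc m)))) ⟩
  (f ⊛ g) m +ᶻ + 0
    ≡⟨ ℤ.+-identityʳ _ ⟩
  (f ⊛ g) m
    ∎
  where open ≡-Reasoning

shift-⊛ : ∀ a f g → shift a f ⊛ g ≈ shift a (f ⊛ g)
shift-⊛ zero    f g = λ _ → refl
shift-⊛ (suc a) f g m = trans (shift₁-⊛ (shift a f) g m) (shift₁-cong (shift-⊛ a f g) m)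

⊛-shift : ∀ a f g → f ⊛ shift a g ≈ shift a (f ⊛ g)
⊛-shift zero    f g = λ _ → refl
⊛-shift (suc a) f g m = trans (⊛-shift₁ f (shift a g) m) (shift₁-cong (⊛-shift a f g) m)

qpow≈shift-one : ∀ a → qpow a ≈ shift a one
qpow≈shift-one zero    zero    = refl
qpow≈shift-one zero    (suc m) = refl
qpow≈shift-one (suc a) zero    = refl
qpow≈shift-one (suc a) (suc m) = qpow≈shift-one a m

qpow-⊛ : ∀ a f → qpow a ⊛ f ≈ shift a f
qpow-⊛ a f m = begin
  (qpow a ⊛ f) m        ≡⟨ ⊛-congˡ f (qpow≈shift-one a) m ⟩
  (shift a one ⊛ f) m   ≡⟨ shift-⊛ a one f m ⟩
  shift a (one ⊛ f) m   ≡⟨ shift-cong a (⊛-identityˡ f) m ⟩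
  shift a f m           ∎
  where open ≡-Reasoning

⊛-qpow : ∀ a f → f ⊛ qpow a ≈ shift a f
⊛-qpow a f m = begin
  (f ⊛ qpow a) m        ≡⟨ ⊛-congʳ f (qpow≈shift-one a) m ⟩
  (f ⊛ shift a one) m   ≡⟨ ⊛-shift a f one m ⟩
  shift a (f ⊛ one) m   ≡⟨ shift-cong a (⊛-identityʳ f) m ⟩
  shift a f m           ∎
  where open ≡-Reasoning

-- With g = 1 - f, iterating h = 1 + g h gives h = Σ_{k ≤ K} g^k + g^{K+1} h, and the
-- remainder g^{K+1} h has no terms below q^{K+1} because g has no constant term.
module _ {f h : PS} (f₀≡1 : f 0 ≡ + 1) (f⊛h≈one : f ⊛ h ≈ one) where

  private
    g : PS
    g = one ⊖ f

    partialSum : ℕ → PS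
    partialSum K m = sumTo K (λ k → (g ^ˢ k) m)

    remainder : ℕ → PS
    remainder zero    = g ⊛ h
    remainder (suc K) = g ⊛ remainder K

    h≈one⊕g⊛h : h ≈ one ⊕ g ⊛ h
    h≈one⊕g⊛h m = begin
      h m                                 ≡⟨ split (h m) (one m) ⟩
      one m +ᶻ (h m -ᶻ one m)             ≡⟨ cong (one m +ᶻ_) (cong₂ _-ᶻ_ (⊛-identityˡ h m) (f⊛h≈one m)) ⟨
      one m +ᶻ ((one ⊛ h) m -ᶻ (f ⊛ h) m) ≡⟨ cong (one m +ᶻ_) (⊛-distribʳ-⊖ one f h m) ⟨
      one m +ᶻ (g ⊛ h) m                  ∎
      where
      open ≡-Reasoning
      split : ∀ x y → x ≡ y +ᶻ (x -ᶻ y)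
      split = solve-∀

    g⊛partialSum : ∀ K m → (g ⊛ partialSum K) m ≡ sumTo K (λ k → (g ^ˢ suc k) m)
    g⊛partialSum K m =
      trans (sumTo-cong m λ i _ → *-distribˡ-sumTo K (g i) (λ k → (g ^ˢ k) (m ∸ i)))
            (sumTo-comm m K (λ i k → g i *ᶻ (g ^ˢ k) (m ∸ i)))

    expansion : ∀ K → h ≈ partialSum K ⊕ remainder K
    expansion zero      = h≈one⊕g⊛h
    expansion (suc K) m = begin
      h m
        ≡⟨ h≈one⊕g⊛h m ⟩
      one m +ᶻ (g ⊛ h) m
        ≡⟨ cong (one m +ᶻ_) (⊛-congʳ g (expansion K) m) ⟩
      one m +ᶻ (g ⊛ (partialSum K ⊕ remainder K)) m
        ≡⟨ cong (one m +ᶻ_) (⊛-distribˡ-⊕ g (partialSum K) (remainder K) m) ⟩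
      one m +ᶻ ((g ⊛ partialSum K) m +ᶻ remainder (suc K) m)
        ≡⟨ cong (λ x → one m +ᶻ (x +ᶻ remainder (suc K) m)) (g⊛partialSum K m) ⟩
      one m +ᶻ (sumTo K (λ k → (g ^ˢ suc k) m) +ᶻ remainder (suc K) m)
        ≡⟨ ℤ.+-assoc (one m) _ _ ⟨
      one m +ᶻ sumTo K (λ k → (g ^ˢ suc k) m) +ᶻ remainder (suc K) m
        ≡⟨ cong (_+ᶻ remainder (suc K) m) (sumTo-suc K (λ k → (g ^ˢ k) m)) ⟨
      partialSum (suc K) m +ᶻ remainder (suc K) m
        ∎
      where open ≡-Reasoning

    g₀≡0 : g 0 ≡ + 0
    g₀≡0 = cong (+ 1 -ᶻ_) f₀≡1

    remainder-vanishes : ∀ K m → m ≤ K → remainder K m ≡ + 0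
    remainder-vanishes zero    zero    _   = cong (_*ᶻ h 0) g₀≡0
    remainder-vanishes (suc K) m       m≤K = sumTo-zero m term-vanishes
      where
      term-vanishes : ∀ i → i ≤ m → g i *ᶻ remainder K (m ∸ i) ≡ + 0
      term-vanishes zero    _ = cong (_*ᶻ remainder K m) g₀≡0
      term-vanishes (suc i) _ = trans (cong (g (suc i) *ᶻ_) (remainder-vanishes K (m ∸ suc i) m∸1+i≤K))
                                      (ℤ.*-zeroʳ (g (suc i)))
        where
        m∸1+i≤K : m ∸ suc i ≤ K
        m∸1+i≤K = ℕ.≤-trans (ℕ.∸-monoʳ-≤ m (s≤s z≤n)) (ℕ.∸-monoˡ-≤ 1 m≤K)

  inv₁-unique : inv₁ f ≈ h
  inv₁-unique n = sym (begin
    h n                             ≡⟨ expansion n n ⟩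
    partialSum n n +ᶻ remainder n n ≡⟨ cong (partialSum n n +ᶻ_) (remainder-vanishes n n ℕ.≤-refl) ⟩
    partialSum n n +ᶻ + 0           ≡⟨ ℤ.+-identityʳ _ ⟩
    inv₁ f n                        ∎)
    where open ≡-Reasoning

one⊖qpow-⊛ : ∀ a f → (one ⊖ qpow a) ⊛ f ≈ f ⊖ shift a f
one⊖qpow-⊛ a f m = trans (⊛-distribʳ-⊖ one (qpow a) f m) (cong₂ _-ᶻ_ (⊛-identityˡ f m) (qpow-⊛ a f m))

⊛-one⊖qpow-⊛ : ∀ a f g → (f ⊛ (one ⊖ qpow a)) ⊛ g ≈ f ⊛ (g ⊖ shift a g)
⊛-one⊖qpow-⊛ a f g m = begin
  ((f ⊛ (one ⊖ qpow a)) ⊛ g) m   ≡⟨ ⊛-congˡ g f⊛[one⊖qpow] m ⟩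
  ((f ⊖ shift a f) ⊛ g) m        ≡⟨ ⊛-distribʳ-⊖ f (shift a f) g m ⟩
  (f ⊛ g) m -ᶻ (shift a f ⊛ g) m ≡⟨ cong ((f ⊛ g) m -ᶻ_) (trans (shift-⊛ a f g m) (sym (⊛-shift a f g m))) ⟩
  (f ⊛ g) m -ᶻ (f ⊛ shift a g) m ≡⟨ ⊛-distribˡ-⊖ f g (shift a g) m ⟨
  (f ⊛ (g ⊖ shift a g)) m        ∎
  where
  open ≡-Reasoning
  f⊛[one⊖qpow] : f ⊛ (one ⊖ qpow a) ≈ f ⊖ shift a f
  f⊛[one⊖qpow] k = trans (⊛-distribˡ-⊖ f one (qpow a) k) (cong₂ _-ᶻ_ (⊛-identityʳ f k) (⊛-qpow a f k))

-- f(q) ↦ f(q²)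
dilate : PS → PS
dilate f zero          = f 0
dilate f (suc zero)    = + 0
dilate f (suc (suc m)) = dilate (f ∘ suc) m

dilate-cong : ∀ {f g} → f ≈ g → dilate f ≈ dilate g
dilate-cong f≈g zero          = f≈g 0
dilate-cong f≈g (suc zero)    = refl
dilate-cong f≈g (suc (suc m)) = dilate-cong (f≈g ∘ suc) m

dilate-even : ∀ f k → dilate f (2 * k) ≡ f k
dilate-even f zero    = refl
dilate-even f (suc k) = trans (cong (dilate f) (ℕ.*-suc 2 k)) (dilate-even (f ∘ suc) k)

dilate-odd : ∀ f k → dilate f (suc (2 * k)) ≡ + 0
dilate-odd f zero    = refl
dilate-odd f (suc k) = trans (cong (dilate f ∘ suc) (ℕ.*-suc 2 k)) (dilate-odd (f ∘ suc) k)

dilate-⊖ : ∀ f g → dilate (f ⊖ g) ≈ dilate f ⊖ dilate g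
dilate-⊖ f g zero          = refl
dilate-⊖ f g (suc zero)    = refl
dilate-⊖ f g (suc (suc m)) = dilate-⊖ (f ∘ suc) (g ∘ suc) m

dilate-one : dilate one ≈ one
dilate-one zero          = refl
dilate-one (suc zero)    = refl
dilate-one (suc (suc m)) = dilate-zero m
  where
  dilate-zero : dilate (λ _ → + 0) ≈ λ _ → + 0
  dilate-zero zero          = refl
  dilate-zero (suc zero)    = refl
  dilate-zero (suc (suc m)) = dilate-zero m

shift-2*-dilate : ∀ a f → shift (2 * a) (dilate f) ≈ dilate (shift a f)
shift-2*-dilate zero    f m = refl
shift-2*-dilate (suc a) f m = begin
  shift (2 * suc a) (dilate f) m                 ≡⟨ cong (λ b → shift b (dilate f) m) (ℕ.*-suc 2 a) ⟩
  shift₁ (shift₁ (shift (2 * a) (dilate f))) m   ≡⟨ shift₁-cong (shift₁-cong (shift-2*-dilate a f)) m ⟩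
  shift₁ (shift₁ (dilate (shift a f))) m         ≡⟨ shift₁²-dilate (shift a f) m ⟩
  dilate (shift (suc a) f) m                     ∎
  where
  open ≡-Reasoning
  shift₁²-dilate : ∀ g → shift₁ (shift₁ (dilate g)) ≈ dilate (shift₁ g)
  shift₁²-dilate g zero          = refl
  shift₁²-dilate g (suc zero)    = refl
  shift₁²-dilate g (suc (suc m)) = refl

shift₁-dilate-even : ∀ f k → shift₁ (dilate f) (2 * k) ≡ + 0
shift₁-dilate-even f zero    = refl
shift₁-dilate-even f (suc k) = trans (cong (shift₁ (dilate f)) (ℕ.*-suc 2 k)) (dilate-odd f k)

dilate-⊖-shift : ∀ a f → dilate f ⊖ shift (2 * a) (dilate f) ≈ dilate (f ⊖ shift a f)
dilate-⊖-shift a f m =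
  trans (cong (dilate f m -ᶻ_) (shift-2*-dilate a f m)) (sym (dilate-⊖ f (shift a f) m))

PartSizes : List ℕ → Set
PartSizes vs = All (1 ≤_) vs × AllPairs _>_ vs

PartitionInto : List ℕ → ℕ → List ℕ → Set
PartitionInto vs m p = IsPartition m p × All (_∈ vs) p

[]-isPartition : IsPartition 0 []
[]-isPartition = record { positive = [] ; nonIncr = [] ; sumEq = refl }

∷-isPartition : ∀ {v m r} → 1 ≤ v → All (_≤ v) r → IsPartition m r → IsPartition (v + m) (v ∷ r)
∷-isPartition {v} 1≤v r≤v r-part = record
  { positive = 1≤v ∷ positive r-part
  ; nonIncr  = linked r≤v (nonIncr r-part)
  ; sumEq    = cong (v ℕ.+_) (sumEq r-part)
  }
  where
  linked : ∀ {r} → All (_≤ v) r → Linked _≥_ r → Linked _≥_ (v ∷ r)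
  linked []           _ = [-]
  linked (x≤v ∷ _) r↓ = x≤v ∷ r↓

isPartition-∷⁻ : ∀ {m x r} → IsPartition m (x ∷ r) → IsPartition (m ∸ x) r
isPartition-∷⁻ {m} {x} {r} p = record
  { positive = All.tail (positive p)
  ; nonIncr  = Linked.tail (nonIncr p)
  ; sumEq    = trans (sym (ℕ.m+n∸m≡n x (sum r))) (cong (_∸ x) (sumEq p))
  }

isPartition-head≤ : ∀ {m x r} → IsPartition m (x ∷ r) → x ≤ m
isPartition-head≤ {x = x} {r} p = subst (x ≤_) (sumEq p) (ℕ.m≤m+n x (sum r))

-- withCopies v vs f m lists the partitions of m into parts from v ∷ vs; the fuel f ≥ m
-- only serves to make the recursion on m ∸ v structural.
partitions : List ℕ → ℕ → List (List ℕ)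
withCopies : ℕ → List ℕ → ℕ → ℕ → List (List ℕ)

partitions []       zero    = [ [] ]
partitions []       (suc m) = []
partitions (v ∷ vs) m       = withCopies v vs m m

withCopies v vs zero    m = partitions vs m
withCopies v vs (suc f) m with v ≤? m
... | yes _ = partitions vs m ++ map (v ∷_) (withCopies v vs f (m ∸ v))
... | no  _ = partitions vs m

withCopies-< : ∀ {v vs} f {m} → m < v → withCopies v vs f m ≡ partitions vs m
withCopies-< zero    m<v = refl
withCopies-< {v} (suc f) {m} m<v with v ≤? m
... | yes v≤m = ⊥-elim (ℕ.<⇒≱ m<v v≤m)
... | no  _   = refl

withCopies-≤ : ∀ {v vs} f {m} → v ≤ m →
  withCopies v vs (suc f) m ≡ partitions vs m ++ map (v ∷_) (withCopies v vs f (m ∸ v))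
withCopies-≤ {v} f {m} v≤m with v ≤? m
... | yes _   = refl
... | no  v≰m = ⊥-elim (v≰m v≤m)

∸-fuel : ∀ {v m f} → 1 ≤ v → m ≤ suc f → m ∸ v ≤ f
∸-fuel {v} {m} 1≤v m≤1+f = ℕ.≤-trans (ℕ.∸-monoʳ-≤ m 1≤v) (ℕ.∸-monoˡ-≤ 1 m≤1+f)

withCopies-fuel : ∀ {v vs} → 1 ≤ v → ∀ f g {m} → m ≤ f → m ≤ g →
  withCopies v vs f m ≡ withCopies v vs g m
withCopies-fuel 1≤v zero    zero    _   _   = refl
withCopies-fuel 1≤v zero    (suc g) z≤n _   = sym (withCopies-< (suc g) 1≤v)
withCopies-fuel 1≤v (suc f) zero    _   z≤n = withCopies-< (suc f) 1≤v
withCopies-fuel {v} {vs} 1≤v (suc f) (suc g) {m} m≤f m≤g with v ≤? m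
... | yes _ = cong (λ ps → partitions vs m ++ map (v ∷_) ps)
                   (withCopies-fuel 1≤v f g (∸-fuel 1≤v m≤f) (∸-fuel 1≤v m≤g))
... | no  _ = refl

partitions-∷-≤ : ∀ {v vs m} → 1 ≤ v → v ≤ m →
  partitions (v ∷ vs) m ≡ partitions vs m ++ map (v ∷_) (partitions (v ∷ vs) (m ∸ v))
partitions-∷-≤ {m = zero}  (s≤s _) ()
partitions-∷-≤ {v} {vs} {suc m} 1≤v v≤m = trans (withCopies-≤ m v≤m)
  (cong (λ ps → partitions vs (suc m) ++ map (v ∷_) ps)
        (withCopies-fuel 1≤v m (suc m ∸ v) (∸-fuel 1≤v ℕ.≤-refl) ℕ.≤-refl))

count : List ℕ → ℕ → ℕ
count vs m = length (partitions vs m)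

count-zero : ∀ vs → count vs 0 ≡ 1
count-zero []       = refl
count-zero (v ∷ vs) = count-zero vs

count-∷-< : ∀ {v vs m} → m < v → count (v ∷ vs) m ≡ count vs m
count-∷-< {m = m} m<v = cong length (withCopies-< m m<v)

count-∷-≤ : ∀ {v vs m} → 1 ≤ v → v ≤ m → count (v ∷ vs) m ≡ count vs m + count (v ∷ vs) (m ∸ v)
count-∷-≤ {v} {vs} {m} 1≤v v≤m = begin
  count (v ∷ vs) m
    ≡⟨ cong length (partitions-∷-≤ 1≤v v≤m) ⟩
  length (partitions vs m ++ map (v ∷_) (partitions (v ∷ vs) (m ∸ v)))
    ≡⟨ length-++ (partitions vs m) ⟩
  count vs m + length (map (v ∷_) (partitions (v ∷ vs) (m ∸ v)))
    ≡⟨ cong (count vs m ℕ.+_) (length-map {A = List ℕ} (v ∷_) (partitions (v ∷ vs) (m ∸ v))) ⟩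
  count vs m + count (v ∷ vs) (m ∸ v)
    ∎
  where open ≡-Reasoning

count-∷-self : ∀ {v vs} → 1 ≤ v → count (v ∷ vs) v ≡ count vs v + 1
count-∷-self {v} {vs} 1≤v = trans (count-∷-≤ 1≤v ℕ.≤-refl)
  (cong (count vs v ℕ.+_) (trans (cong (count (v ∷ vs)) (ℕ.n∸n≡0 v)) (count-zero (v ∷ vs))))

partitionGF : List ℕ → PS
partitionGF vs m = + count vs m

partitionGF-[] : partitionGF [] ≈ one
partitionGF-[] zero    = refl
partitionGF-[] (suc m) = refl

partitionGF-∷ : ∀ {v vs} → 1 ≤ v → partitionGF (v ∷ vs) ⊖ shift v (partitionGF (v ∷ vs)) ≈ partitionGF vs
partitionGF-∷ {v} {vs} 1≤v m with v ℕ.≤? m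
... | yes v≤m = begin
  + count (v ∷ vs) m -ᶻ shift v (partitionGF (v ∷ vs)) m
    ≡⟨ cong₂ _-ᶻ_ (cong +_ (count-∷-≤ 1≤v v≤m)) (shift-≤ v _ v≤m) ⟩
  + count vs m +ᶻ + count (v ∷ vs) (m ∸ v) -ᶻ + count (v ∷ vs) (m ∸ v)
    ≡⟨ cancel (+ count vs m) (+ count (v ∷ vs) (m ∸ v)) ⟩
  + count vs m
    ∎
  where
  open ≡-Reasoning
  cancel : ∀ a b → a +ᶻ b -ᶻ b ≡ a
  cancel = solve-∀
... | no v≰m = trans (cong₂ _-ᶻ_ (cong +_ (count-∷-< (ℕ.≰⇒> v≰m))) (shift-< v _ (ℕ.≰⇒> v≰m)))
                     (ℤ.+-identityʳ (+ count vs m))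

module _ {v : ℕ} {vs : List ℕ} (vs<v : All (_< v) vs) where

  ∈-∷⇒≤ : ∀ {x} → x ∈ v ∷ vs → x ≤ v
  ∈-∷⇒≤ (here refl) = ℕ.≤-refl
  ∈-∷⇒≤ (there x∈)  = ℕ.<⇒≤ (All.lookup vs<v x∈)

  ∈-∷⇒∈ : ∀ {x y} → x ∈ vs → y ≤ x → y ∈ v ∷ vs → y ∈ vs
  ∈-∷⇒∈ x∈ y≤x (here refl) = ⊥-elim (ℕ.<⇒≱ (All.lookup vs<v x∈) y≤x)
  ∈-∷⇒∈ x∈ y≤x (there y∈)  = y∈

  ∉-head : ∀ {r} → ¬ All (_∈ vs) (v ∷ r)
  ∉-head (v∈ ∷ _) = ℕ.<-irrefl refl (All.lookup vs<v v∈)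

widen : ∀ {v vs m p} → PartitionInto vs m p → PartitionInto (v ∷ vs) m p
widen (p-part , p⊆) = p-part , All.map there p⊆

partitions-sound : ∀ {vs m p} → PartSizes vs → p ∈ partitions vs m → PartitionInto vs m p
withCopies-sound : ∀ {v vs f m p} → PartSizes (v ∷ vs) → p ∈ withCopies v vs f m → PartitionInto (v ∷ vs) m p

partitions-sound {[]}     {zero} _ (here refl) = []-isPartition , []
partitions-sound {v ∷ vs} {m}    sizes p∈      = withCopies-sound {f = m} sizes p∈

withCopies-sound {f = zero} (_ ∷ pos , _ ∷ desc) p∈ = widen (partitions-sound (pos , desc) p∈)
withCopies-sound {v} {vs} {suc f} {m} sizes@(1≤v ∷ pos , vs<v ∷ desc) p∈ with v ≤? m
... | no _ = widen (partitions-sound (pos , desc) p∈)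
... | yes v≤m with ∈-++⁻ (partitions vs m) p∈
...   | inj₁ p∈vs = widen (partitions-sound (pos , desc) p∈vs)
...   | inj₂ p∈v∷ with ∈-map⁻ (v ∷_) p∈v∷
...     | r , r∈ , refl with withCopies-sound {f = f} sizes r∈
...       | r-part , r⊆ =
  subst (λ n → IsPartition n (v ∷ r)) (ℕ.m+[n∸m]≡n v≤m)
        (∷-isPartition 1≤v (All.map (∈-∷⇒≤ vs<v) r⊆) r-part)
  , here refl ∷ r⊆

partitions⊆withCopies : ∀ {v vs} f {m p} → p ∈ partitions vs m → p ∈ withCopies v vs f m
partitions⊆withCopies zero            p∈ = p∈
partitions⊆withCopies {v} (suc f) {m} p∈ with v ≤? m
... | yes _ = ∈-++⁺ˡ p∈
... | no  _ = p∈

partitions-complete : ∀ {vs m p} → PartSizes vs → PartitionInto vs m p → p ∈ partitions vs m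
withCopies-complete : ∀ {v vs f m p} → PartSizes (v ∷ vs) → m ≤ f → PartitionInto (v ∷ vs) m p →
  p ∈ withCopies v vs f m

partitions-complete {[]} {p = []} _ (p-part , []) rewrite sym (sumEq p-part) = here refl
partitions-complete {v ∷ vs} sizes p-into = withCopies-complete sizes ℕ.≤-refl p-into

withCopies-complete {f = f} {p = []} (_ ∷ pos , _ ∷ desc) _ (p-part , []) =
  partitions⊆withCopies f (partitions-complete (pos , desc) (p-part , []))
withCopies-complete {f = f} {p = x ∷ r} (_ ∷ pos , vs<v ∷ desc) _ (p-part , there x∈ ∷ r⊆) =
  partitions⊆withCopies f
    (partitions-complete (pos , desc) (p-part , x∈ ∷ All.zipWith (uncurry (∈-∷⇒∈ vs<v x∈)) (r≤x , r⊆)))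
  where
  r≤x : All (_≤ x) r
  r≤x with Linked⇒AllPairs (flip ℕ.≤-trans) (nonIncr p-part)
  ... | x≥r ∷ _ = x≥r
withCopies-complete {f = zero} {p = v ∷ r} (1≤v ∷ _ , _) m≤0 (p-part , here refl ∷ _) =
  ⊥-elim (ℕ.<⇒≱ (ℕ.≤-trans 1≤v (isPartition-head≤ p-part)) m≤0)
withCopies-complete {v} {vs} {suc f} {m} {v ∷ r} sizes@(1≤v ∷ _ , _) m≤f (p-part , here refl ∷ r⊆) with v ≤? m
... | no v≰m  = ⊥-elim (v≰m (isPartition-head≤ p-part))
... | yes v≤m = ∈-++⁺ʳ (partitions vs m)
  (∈-map⁺ (v ∷_) (withCopies-complete sizes (∸-fuel 1≤v m≤f) (isPartition-∷⁻ p-part , r⊆)))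

partitions-unique : ∀ {vs m} → PartSizes vs → Unique (partitions vs m)
withCopies-unique : ∀ {v vs f m} → PartSizes (v ∷ vs) → Unique (withCopies v vs f m)

partitions-unique {[]}     {zero}  _     = [] ∷ []
partitions-unique {[]}     {suc m} _     = []
partitions-unique {v ∷ vs} {m}     sizes = withCopies-unique {f = m} sizes

withCopies-unique {f = zero} (_ ∷ pos , _ ∷ desc) = partitions-unique (pos , desc)
withCopies-unique {v} {vs} {suc f} {m} sizes@(_ ∷ pos , vs<v ∷ desc) with v ≤? m
... | no  _ = partitions-unique (pos , desc)
... | yes _ = Unique.++⁺ (partitions-unique (pos , desc))
                        (Unique.map⁺ ∷-injectiveʳ (withCopies-unique {f = f} sizes)) disjoint
  where
  disjoint : ∀ {p} → ¬ (p ∈ partitions vs m × p ∈ map (v ∷_) (withCopies v vs f (m ∸ v)))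
  disjoint (p∈vs , p∈v∷) with ∈-map⁻ (v ∷_) p∈v∷
  ... | _ , _ , refl = ∉-head vs<v (proj₂ (partitions-sound (pos , desc) p∈vs))

data Parity : ℕ → Set where
  even : ∀ k → Parity (2 * k)
  odd  : ∀ k → Parity (suc (2 * k))

parity : ∀ n → Parity n
parity zero    = even 0
parity (suc n) with parity n
... | even k = odd k
... | odd  k = subst Parity (ℕ.*-suc 2 k) (even (suc k))

odds : ℕ → List ℕ
odds zero    = []
odds (suc j) = suc (2 * j) ∷ odds j

1+2*j<2*[1+j] : ∀ j → suc (2 * j) < 2 * suc j
1+2*j<2*[1+j] j = subst (suc (2 * j) <_) (sym (ℕ.*-suc 2 j)) (ℕ.n<1+n (suc (2 * j)))

∈-odds⁻ : ∀ {j x} → x ∈ odds j → Odd x × x < 2 * j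
∈-odds⁻ {suc j} (here refl) = (j , refl) , 1+2*j<2*[1+j] j
∈-odds⁻ {suc j} (there x∈)  with ∈-odds⁻ x∈
... | x-odd , x<2j = x-odd , ℕ.<-≤-trans x<2j (ℕ.*-monoʳ-≤ 2 (ℕ.n≤1+n j))

∈-odds⁺ : ∀ {j x} → Odd x → x < 2 * j → x ∈ odds j
∈-odds⁺ {zero}  (k , refl) ()
∈-odds⁺ {suc j} (k , refl) x<2[1+j] with k ℕ.≟ j
... | yes refl = here refl
... | no  k≢j  = there (∈-odds⁺ (k , refl) (subst (_≤ 2 * j) (ℕ.*-suc 2 k) (ℕ.*-monoʳ-≤ 2 k<j)))
  where
  k<j : k < j
  k<j = ℕ.≤∧≢⇒< (ℕ.≤-pred (ℕ.*-cancelˡ-< 2 k (suc j) (ℕ.<-trans (ℕ.n<1+n (2 * k)) x<2[1+j]))) k≢j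

∈-odds⇔ : ∀ {j x} → x ∈ odds j ⇔ (Odd x × x < 2 * j)
∈-odds⇔ = mk⇔ ∈-odds⁻ λ (x-odd , x<2j) → ∈-odds⁺ x-odd x<2j

odds-partSizes : ∀ j → PartSizes (odds j)
odds-partSizes zero    = [] , []
odds-partSizes (suc j) with odds-partSizes j
... | pos , desc = s≤s z≤n ∷ pos , All.tabulate (λ x∈ → ℕ.m<n⇒m<1+n (proj₂ (∈-odds⁻ x∈))) ∷ desc

count-odds-stable : ∀ {j J m} → j ≤ J → m ≤ 2 * j → count (odds J) m ≡ count (odds j) m
count-odds-stable {j} {m = m} j≤J m≤2j = go (ℕ.≤⇒≤′ j≤J)
  where
  go : ∀ {J} → j ≤′ J → count (odds J) m ≡ count (odds j) m
  go ℕ.≤′-refl         = refl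
  go (ℕ.≤′-step j≤′J) = trans (count-∷-< (s≤s (ℕ.≤-trans m≤2j (ℕ.*-monoʳ-≤ 2 (ℕ.≤′⇒≤ j≤′J))))) (go j≤′J)

4*n+2≡2*[1+2*n] : ∀ n → 4 * n + 2 ≡ 2 * suc (2 * n)
4*n+2≡2*[1+2*n] = ℕ-Solver.solve-∀

poch-q2-q4-⊛ : ∀ N → poch-q2-q4 N ⊛ dilate (partitionGF (odds N)) ≈ one
poch-q2-q4-⊛ zero m = begin
  (one ⊛ dilate (partitionGF [])) m ≡⟨ ⊛-identityˡ (dilate (partitionGF [])) m ⟩
  dilate (partitionGF []) m         ≡⟨ dilate-cong partitionGF-[] m ⟩
  dilate one m                      ≡⟨ dilate-one m ⟩
  one m                             ∎
  where open ≡-Reasoning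
poch-q2-q4-⊛ (suc N) m = begin
  ((poch-q2-q4 N ⊛ (one ⊖ qpow (4 * N + 2))) ⊛ dilate P′) m
    ≡⟨ ⊛-one⊖qpow-⊛ (4 * N + 2) (poch-q2-q4 N) (dilate P′) m ⟩
  (poch-q2-q4 N ⊛ (dilate P′ ⊖ shift (4 * N + 2) (dilate P′))) m
    ≡⟨ ⊛-congʳ (poch-q2-q4 N) factor m ⟩
  (poch-q2-q4 N ⊛ dilate (partitionGF (odds N))) m
    ≡⟨ poch-q2-q4-⊛ N m ⟩
  one m
    ∎
  where
  open ≡-Reasoning
  P′ : PS
  P′ = partitionGF (odds (suc N))
  factor : dilate P′ ⊖ shift (4 * N + 2) (dilate P′) ≈ dilate (partitionGF (odds N))
  factor k = begin
    (dilate P′ ⊖ shift (4 * N + 2) (dilate P′)) k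
      ≡⟨ cong (λ a → (dilate P′ ⊖ shift a (dilate P′)) k) (4*n+2≡2*[1+2*n] N) ⟩
    (dilate P′ ⊖ shift (2 * suc (2 * N)) (dilate P′)) k    ≡⟨ dilate-⊖-shift (suc (2 * N)) P′ k ⟩
    dilate (P′ ⊖ shift (suc (2 * N)) P′) k                 ≡⟨ dilate-cong (partitionGF-∷ (s≤s z≤n)) k ⟩
    dilate (partitionGF (odds N)) k                         ∎

poch-q2-q4-const : ∀ N → poch-q2-q4 N 0 ≡ + 1
poch-q2-q4-const zero    = refl
poch-q2-q4-const (suc N) =
  cong₂ (λ c a → c *ᶻ (+ 1 -ᶻ qpow a 0)) (poch-q2-q4-const N) (ℕ.+-comm (4 * N) 2)

inv₁-poch-q2-q4 : ∀ N → inv₁ (poch-q2-q4 N) ≈ dilate (partitionGF (odds N))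
inv₁-poch-q2-q4 N = inv₁-unique (poch-q2-q4-const N) (poch-q2-q4-⊛ N)

ones : PS
ones _ = + 1

inv₁-one⊖q⁴ : inv₁ (one ⊖ qpow 4) ≈ dilate (dilate ones)
inv₁-one⊖q⁴ = inv₁-unique refl λ m → begin
  ((one ⊖ qpow 4) ⊛ dilate (dilate ones)) m                     ≡⟨ one⊖qpow-⊛ 4 (dilate (dilate ones)) m ⟩
  (dilate (dilate ones) ⊖ shift (2 * 2) (dilate (dilate ones))) m ≡⟨ dilate-⊖-shift 2 (dilate ones) m ⟩
  dilate (dilate ones ⊖ shift (2 * 1) (dilate ones)) m           ≡⟨ dilate-cong (dilate-⊖-shift 1 ones) m ⟩
  dilate (dilate (ones ⊖ shift 1 ones)) m                        ≡⟨ dilate-cong (dilate-cong ones-geometric) m ⟩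
  dilate (dilate one) m                                          ≡⟨ dilate-cong dilate-one m ⟩
  dilate one m                                                   ≡⟨ dilate-one m ⟩
  one m                                                          ∎
  where
  open ≡-Reasoning
  ones-geometric : ones ⊖ shift 1 ones ≈ one
  ones-geometric zero    = refl
  ones-geometric (suc m) = refl

halfRhs : ℕ → PS
halfRhs N = partitionGF (odds N) ⊖ shift 1 (dilate ones) ⊖ one

rhsN≈dilate-halfRhs : ∀ N → rhsN N ≈ dilate (halfRhs N)
rhsN≈dilate-halfRhs N m = begin
  rhsN N m
    ≡⟨ cong₂ (λ a b → a -ᶻ b -ᶻ one m) (inv₁-poch-q2-q4 N m) q²/[1-q⁴] ⟩
  dilate (partitionGF (odds N)) m -ᶻ dilate (shift 1 (dilate ones)) m -ᶻ one m
    ≡⟨ cong₂ _-ᶻ_ (dilate-⊖ (partitionGF (odds N)) (shift 1 (dilate ones)) m) (dilate-one m) ⟨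
  dilate (partitionGF (odds N) ⊖ shift 1 (dilate ones)) m -ᶻ dilate one m
    ≡⟨ dilate-⊖ (partitionGF (odds N) ⊖ shift 1 (dilate ones)) one m ⟨
  dilate (halfRhs N) m ∎
  where
  open ≡-Reasoning
  q²/[1-q⁴] : (qpow 2 ⊛ inv₁ (one ⊖ qpow 4)) m ≡ dilate (shift 1 (dilate ones)) m
  q²/[1-q⁴] = begin
    (qpow 2 ⊛ inv₁ (one ⊖ qpow 4)) m   ≡⟨ qpow-⊛ 2 (inv₁ (one ⊖ qpow 4)) m ⟩
    shift 2 (inv₁ (one ⊖ qpow 4)) m    ≡⟨ shift-cong 2 inv₁-one⊖q⁴ m ⟩
    shift (2 * 1) (dilate (dilate ones)) m ≡⟨ shift-2*-dilate 1 (dilate ones) m ⟩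
    dilate (shift 1 (dilate ones)) m   ∎

RhoOEnumeration : ℕ → ℤ → Set
RhoOEnumeration n c =
  Σ (List (List ℕ)) λ L → Unique L × ((p : List ℕ) → (p ∈ L) ⇔ (IsPartition n p × RhoO p)) × (+ length L ≡ c)

rhoO-double : ∀ {n ℓ rest} → IsPartition n (ℓ ∷ rest) → RhoO (ℓ ∷ rest) → n ≡ 2 * ℓ
rhoO-double {n} {ℓ} {rest} p-part (rhoO _ _ _ _ rest-part) = begin
  n               ≡⟨ sumEq p-part ⟨
  ℓ + sum rest    ≡⟨ cong (ℓ ℕ.+_) (sumEq rest-part) ⟩
  ℓ + ℓ           ≡⟨ cong (ℓ ℕ.+_) (ℕ.+-identityʳ ℓ) ⟨
  2 * ℓ           ∎
  where open ≡-Reasoning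

rhoO-enumeration : ∀ {ℓ vs} → 1 ≤ ℓ → PartSizes vs → (∀ {x} → x ∈ vs ⇔ (Odd x × x < ℓ)) →
  RhoOEnumeration (2 * ℓ) (+ count vs ℓ)
rhoO-enumeration {ℓ} {vs} 1≤ℓ sizes vs-odd<ℓ =
  map (ℓ ∷_) (partitions vs ℓ) ,
  Unique.map⁺ ∷-injectiveʳ (partitions-unique sizes) ,
  (λ p → mk⇔ sound complete) ,
  cong +_ (length-map (ℓ ∷_) (partitions vs ℓ))
  where
  sound : ∀ {p} → p ∈ map (ℓ ∷_) (partitions vs ℓ) → IsPartition (2 * ℓ) p × RhoO p
  sound p∈ with ∈-map⁻ (ℓ ∷_) p∈
  ... | r , r∈ , refl with partitions-sound sizes r∈
  ...   | r-part , r⊆ =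
    subst (λ n → IsPartition n (ℓ ∷ r)) (cong (ℓ ℕ.+_) (sym (ℕ.+-identityʳ ℓ)))
          (∷-isPartition 1≤ℓ (All.map ℕ.<⇒≤ r<ℓ) r-part) ,
    rhoO ℓ r r<ℓ (All.map (proj₁ ∘ to vs-odd<ℓ) r⊆) r-part
    where
    r<ℓ : All (_< ℓ) r
    r<ℓ = All.map (proj₂ ∘ to vs-odd<ℓ) r⊆
  complete : ∀ {p} → IsPartition (2 * ℓ) p × RhoO p → p ∈ map (ℓ ∷_) (partitions vs ℓ)
  complete (p-part , r@(rhoO ℓ′ rest rest<ℓ′ rest-odd rest-part))
    with ℕ.*-cancelˡ-≡ ℓ ℓ′ 2 (rhoO-double p-part r)
  ... | refl = ∈-map⁺ (ℓ ∷_)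
    (partitions-complete sizes (rest-part , All.zipWith (from vs-odd<ℓ ∘ swap) (rest<ℓ′ , rest-odd)))

no-rhoO-partition : ∀ {n} → (∀ ℓ → 1 ≤ ℓ → n ≢ 2 * ℓ) → RhoOEnumeration n (+ 0)
no-rhoO-partition {n} n≢2ℓ = [] , [] , (λ p → mk⇔ (λ ()) absurd) , refl
  where
  absurd : ∀ {p} → IsPartition n p × RhoO p → p ∈ []
  absurd (p-part , r@(rhoO ℓ _ _ _ _)) with positive p-part
  ... | 1≤ℓ ∷ _ = ⊥-elim (n≢2ℓ ℓ 1≤ℓ (rhoO-double p-part r))

halfRhs-zero : ∀ N → halfRhs N 0 ≡ + 0
halfRhs-zero N = cong (λ c → + c -ᶻ + 0 -ᶻ + 1) (count-zero (odds N))

halfRhs-even : ∀ {N} t → suc t ≤ N → halfRhs N (2 * suc t) ≡ + count (odds (suc t)) (2 * suc t)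
halfRhs-even {N} t 1+t≤N = begin
  + count (odds N) ℓ -ᶻ shift₁ (dilate ones) ℓ -ᶻ + 0
    ≡⟨ cong₂ (λ c s → + c -ᶻ s -ᶻ + 0)
             (count-odds-stable 1+t≤N ℕ.≤-refl) (shift₁-dilate-even ones (suc t)) ⟩
  + count (odds (suc t)) ℓ -ᶻ + 0 -ᶻ + 0
    ≡⟨ minus-zero (+ count (odds (suc t)) ℓ) ⟩
  + count (odds (suc t)) ℓ ∎
  where
  open ≡-Reasoning
  ℓ : ℕ
  ℓ = 2 * suc t
  minus-zero : ∀ a → a -ᶻ + 0 -ᶻ + 0 ≡ a
  minus-zero = solve-∀

-- the odd part ℓ itself is the one partition of ℓ into odd parts that is not below ℓ
halfRhs-odd : ∀ {N} t → t < N → halfRhs N (suc (2 * t)) ≡ + count (odds t) (suc (2 * t))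
halfRhs-odd {N} t t<N = begin
  + count (odds N) ℓ -ᶻ dilate ones (2 * t) -ᶻ + 0
    ≡⟨ cong₂ (λ c s → + c -ᶻ s -ᶻ + 0) count-odds-ℓ (dilate-even ones t) ⟩
  + count (odds t) ℓ +ᶻ + 1 -ᶻ + 1 -ᶻ + 0
    ≡⟨ cancel (+ count (odds t) ℓ) ⟩
  + count (odds t) ℓ ∎
  where
  open ≡-Reasoning
  ℓ : ℕ
  ℓ = suc (2 * t)
  count-odds-ℓ : count (odds N) ℓ ≡ count (odds t) ℓ + 1
  count-odds-ℓ = trans (count-odds-stable t<N (ℕ.<⇒≤ (1+2*j<2*[1+j] t))) (count-∷-self {vs = odds t} (s≤s z≤n))
  cancel : ∀ a → a +ᶻ + 1 -ᶻ + 1 -ᶻ + 0 ≡ a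
  cancel = solve-∀

rhoO-enumeration-half : ∀ N ℓ → ℓ ≤ 2 * N → RhoOEnumeration (2 * ℓ) (halfRhs N ℓ)
rhoO-enumeration-half N ℓ ℓ≤2N with parity ℓ
... | even zero = subst (RhoOEnumeration 0) (sym (halfRhs-zero N)) (no-rhoO-partition λ { (suc _) _ () })
... | even (suc t) =
  subst (RhoOEnumeration (2 * (2 * suc t))) (sym (halfRhs-even t (ℕ.*-cancelˡ-≤ {n = N} 2 ℓ≤2N)))
        (rhoO-enumeration (s≤s z≤n) (odds-partSizes (suc t)) ∈-odds⇔)
... | odd t =
  subst (RhoOEnumeration (2 * suc (2 * t))) (sym (halfRhs-odd t (ℕ.*-cancelˡ-< 2 t N ℓ≤2N)))
        (rhoO-enumeration (s≤s z≤n) (odds-partSizes t) ∈-odds-below)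
  where
  ∈-odds-below : ∀ {x} → x ∈ odds t ⇔ (Odd x × x < suc (2 * t))
  ∈-odds-below = mk⇔ (λ x∈ → map₂ ℕ.m<n⇒m<1+n (∈-odds⁻ x∈)) λ where
    ((k , refl) , x<1+2t) →
      ∈-odds⁺ (k , refl) (ℕ.≤∧≢⇒< (ℕ.≤-pred x<1+2t) λ 1+2k≡2t → ℕ.even≢odd t k (sym 1+2k≡2t))

theorem3 : (n N : ℕ) → n < 4 * N + 2 →
    Σ (List (List ℕ)) λ L →
      Unique L
      × ((p : List ℕ) → (p ∈ L) ⇔ (IsPartition n p × RhoO p))
      × (+ (length L) ≡ rhsN N n)
theorem3 n N n<4N+2 with parity n
... | even ℓ = subst (RhoOEnumeration (2 * ℓ)) (sym rhsN-even) (rhoO-enumeration-half N ℓ ℓ≤2N)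
  where
  rhsN-even : rhsN N (2 * ℓ) ≡ halfRhs N ℓ
  rhsN-even = trans (rhsN≈dilate-halfRhs N (2 * ℓ)) (dilate-even (halfRhs N) ℓ)
  ℓ≤2N : ℓ ≤ 2 * N
  ℓ≤2N = ℕ.≤-pred (ℕ.*-cancelˡ-< 2 ℓ (suc (2 * N)) (subst (2 * ℓ <_) (4*n+2≡2*[1+2*n] N) n<4N+2))
... | odd k = subst (RhoOEnumeration (suc (2 * k))) (sym rhsN-odd)
                (no-rhoO-partition λ ℓ _ 1+2k≡2ℓ → ℕ.even≢odd ℓ k (sym 1+2k≡2ℓ))
  where
  rhsN-odd : rhsN N (suc (2 * k)) ≡ + 0
  rhsN-odd = trans (rhsN≈dilate-halfRhs N (suc (2 * k))) (dilate-odd (halfRhs N) k)
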